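{- Let $m\ge1$ and $W=W^{(m)}_4$. For every $\gamma\in A$, $\mathrm{area}(f(\gamma))=\mathrm{area}(\gamma)-1$ and $\mathrm{dinv}_m(f(\gamma))=\mathrm{dinv}_m(\gamma)+1$.
   Context: $W^{(m)}_4$ is the set of sequences $\gamma=(\gamma_0,\gamma_1,\gamma_2,\gamma_3)$ of nonnegative integers with $\gamma_0=0$ and $\gamma_i\le\gamma_{i-1}+m$ for $i=1,2,3$. $\mathrm{area}(\gamma)=\sum_i\gamma_i$ and $\mathrm{dinv}_m(\gamma)=\sum_{0\le i<j\le3}\mathrm{sc}_m(\gamma_i-\gamma_j)$, where $\mathrm{sc}_m(p)=m+1-p$ if $1\le p\le m$, $\mathrm{sc}_m(p)=m+p$ if $-m\le p\le 0$, and $0$ otherwise. For $\gamma\in W$, let $r=r(\gamma)$ be the least $i\in\{2,3\}$ with $\gamma_i-\gamma_{i-2}\le m$, or $r=4$ if none exists. $A_0$ is the set of $\gamma\in W$ with $\gamma_{r-1}-1\le\gamma_3+m$ and $\gamma_1>0$; for $\gamma\in A_0$, $f_0(\gamma)=(\gamma_0,\dots,\gamma_{r-2},\gamma_r,\dots,\gamma_3,\gamma_{r-1}-1)$. $A_1=\{(0,\gamma_1,\gamma_2,\gamma_3)\in W:\gamma_2-\gamma_3>m+1\}$ and $f_1(0,\gamma_1,\gamma_2,\gamma_3)=(0,\gamma_3+1,\gamma_1-1,\gamma_2-1)$. Set $A=A_0\cup A_1$ (a disjoint union) and $f=f_0$ on $A_0$, $f=f_1$ on $A_1$. -}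

module Defs where

open import Data.Nat using (ℕ)
open import Data.Integer using (ℤ; +_; _+_; _-_; _≤_; _<_; _≤?_)
open import Data.Bool using (Bool; true; false; if_then_else_; _∧_)
open import Data.Product using (_×_)
open import Data.Sum using (_⊎_)
open import Relation.Nullary.Decidable using (⌊_⌋)
open import Relation.Binary.PropositionalEquality using (_≡_)

-- A sequence (γ₀, γ₁, γ₂, γ₃) of integers (nonnegativity is part of W).
record Seq4 : Set where
  constructor ⟨_,_,_,_⟩
  field
    g0 g1 g2 g3 : ℤ
open Seq4 public

-- γ_i for i = 0,1,2,3 (indices ≥ 3 read γ₃; only used for i ≤ 3)
at : Seq4 → ℕ → ℤ
at γ 0 = g0 γ
at γ 1 = g1 γ
at γ 2 = g2 γ
at γ _ = g3 γ

InW : ℕ → Seq4 → Set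
InW m γ =
  (g0 γ ≡ + 0) × (+ 0 ≤ g1 γ) × (+ 0 ≤ g2 γ) × (+ 0 ≤ g3 γ) ×
  (g1 γ ≤ g0 γ + + m) × (g2 γ ≤ g1 γ + + m) × (g3 γ ≤ g2 γ + + m)

area : Seq4 → ℤ
area γ = g0 γ + g1 γ + g2 γ + g3 γ

sc : ℕ → ℤ → ℤ
sc m p =
  if ⌊ + 1 ≤? p ⌋ ∧ ⌊ p ≤? + m ⌋ then (+ m + + 1) - p
  else if ⌊ (+ 0 - + m) ≤? p ⌋ ∧ ⌊ p ≤? + 0 ⌋ then + m + p
  else + 0

dinv : ℕ → Seq4 → ℤ
dinv m ⟨ a , b , c , d ⟩ =
  sc m (a - b) + sc m (a - c) + sc m (a - d) +
  sc m (b - c) + sc m (b - d) + sc m (c - d)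

rr : ℕ → Seq4 → ℕ
rr m γ =
  if ⌊ g2 γ - g0 γ ≤? + m ⌋ then 2
  else if ⌊ g3 γ - g1 γ ≤? + m ⌋ then 3
  else 4

InA0 : ℕ → Seq4 → Set
InA0 m γ = InW m γ × (at γ (Data.Nat._∸_ (rr m γ) 1) - + 1 ≤ g3 γ + + m) × (+ 0 < g1 γ)

removeAppend : ℕ → Seq4 → Seq4
removeAppend 1 ⟨ a , b , c , d ⟩ = ⟨ a , c , d , b - + 1 ⟩
removeAppend 2 ⟨ a , b , c , d ⟩ = ⟨ a , b , d , c - + 1 ⟩
removeAppend _ ⟨ a , b , c , d ⟩ = ⟨ a , b , c , d - + 1 ⟩

-- f_0(γ) = (γ₀,…,γ_{r−2},γ_r,…,γ₃,γ_{r−1}−1)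
f0 : ℕ → Seq4 → Seq4
f0 m γ = removeAppend (Data.Nat._∸_ (rr m γ) 1) γ

InA1 : ℕ → Seq4 → Set
InA1 m γ = InW m γ × (g0 γ ≡ + 0) × (+ m + + 1 < g2 γ - g3 γ)

f1 : Seq4 → Seq4
f1 ⟨ a , b , c , d ⟩ = ⟨ + 0 , d + + 1 , b - + 1 , c - + 1 ⟩

InA : ℕ → Seq4 → Set
InA m γ = InA0 m γ ⊎ InA1 m γ

f : (m : ℕ) (γ : Seq4) → InA m γ → Seq4
f m γ (Data.Sum.inj₁ _) = f0 m γ
f m γ (Data.Sum.inj₂ _) = f1 γ

-- Moving an entry x to the end of γ as x − 1 keeps the score of every pair it forms with a
-- later entry, by the symmetry sc(1 − p) = sc(p), and changes the score of a pair (u, x) with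
-- an earlier entry u from sc(u − x) to sc(u − x + 1): a gain of exactly one when
-- −m ≤ u − x < 0, and nothing when u − x < −m, where both scores vanish. The definition of r
-- makes γ_{r−2} the only earlier entry in the first window, so f₀ raises dinv by one. For f₁
-- the same bookkeeping is done pair by pair: the gaps forced by γ₂ − γ₃ > m + 1 make two
-- scores vanish on both sides, and the losses and gains among the rest net to one.
module Submission where

open import Defs
open import Data.Nat using (ℕ)
open import Data.Integer using (ℤ; +_; _+_; _-_)
open import Data.Product using (_×_)
open import Relation.Binary.PropositionalEquality using (_≡_)

open import Data.Bool using (if_then_else_; _∧_)
open import Data.Integer using (_≤_; _<_; _≤?_; +≤+)
open import Data.Integer.Properties
  using ( ≤-trans; ≤-antisym; <⇒≤; <⇒≱; ≰⇒>; ≤-<-trans; <-≤-trans; +-mono-≤; +-monoˡ-≤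
        ; i<j⇒suc[i]≤j; suc[i]≤j⇒i<j)
open import Data.Integer.Tactic.RingSolver using (solve; solve-∀)
open import Data.List using ([]; _∷_)
open import Data.Nat as ℕ using (z≤n)
open import Data.Product using (_,_)
open import Data.Sum using (_⊎_; inj₁; inj₂)
open import Relation.Nullary using (¬_; yes; no; contradiction)
open import Relation.Nullary.Decidable using (⌊_⌋)
open import Relation.Binary.PropositionalEquality
  using (refl; sym; trans; cong; subst₂; module ≡-Reasoning)

open ≡-Reasoning

-- Linear inequalities are derived by adding known ones with +-mono-≤ and matching the gap
-- with the ring solver.
≤-fromGap : ∀ {a b x y : ℤ} → a ≤ b → y - x ≡ b - a → x ≤ y
≤-fromGap {a} {b} {x} {y} a≤b gap = subst₂ _≤_ shiftˡ shiftʳ (+-monoˡ-≤ (x - a) a≤b)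
  where
  shiftˡ : a + (x - a) ≡ x
  shiftˡ = solve (a ∷ x ∷ [])
  shiftʳ : b + (x - a) ≡ y
  shiftʳ = begin
    b + (x - a)  ≡⟨ solve (a ∷ b ∷ x ∷ []) ⟩
    (b - a) + x  ≡⟨ cong (_+ x) (sym gap) ⟩
    (y - x) + x  ≡⟨ solve (x ∷ y ∷ []) ⟩
    y            ∎

<⇒1+≤ : ∀ {x y} → x < y → + 1 + x ≤ y
<⇒1+≤ = i<j⇒suc[i]≤j

1+≤⇒< : ∀ {x y} → + 1 + x ≤ y → x < y
1+≤⇒< = suc[i]≤j⇒i<j

pred-minus-pred : ∀ x y → (x - + 1) - (y - + 1) ≡ x - y
pred-minus-pred = solve-∀

1≰0 : ¬ (+ 1 ≤ + 0)
1≰0 (+≤+ ())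

0≤1 : + 0 ≤ + 1
0≤1 = +≤+ z≤n

≤⊎> : ∀ x y → x ≤ y ⊎ y < x
≤⊎> x y with x ≤? y
... | yes x≤y = inj₁ x≤y
... | no x≰y  = inj₂ (≰⇒> x≰y)

-- dinv m γ and dinvBy (scℤ (+ m)) γ unfold to the same term.
dinvBy : (ℤ → ℤ) → Seq4 → ℤ
dinvBy s ⟨ a , b , c , d ⟩ =
  s (a - b) + s (a - c) + s (a - d) + s (b - c) + s (b - d) + s (c - d)

module _ (s : ℤ → ℤ) (s-reflect : ∀ p → s (+ 1 - p) ≡ s p) where

  s-pred-swap : ∀ x y → s (y - (x - + 1)) ≡ s (x - y)
  s-pred-swap x y = trans (cong s reflection) (s-reflect (x - y))
    where
    reflection : y - (x - + 1) ≡ + 1 - (x - y)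
    reflection = solve (x ∷ y ∷ [])

  dinvBy-removeAppend₁ : ∀ a b c d → s (a - (b - + 1)) ≡ s (a - b) + + 1 →
    dinvBy s (removeAppend 1 ⟨ a , b , c , d ⟩) ≡ dinvBy s ⟨ a , b , c , d ⟩ + + 1
  dinvBy-removeAppend₁ a b c d gain
    rewrite gain | s-pred-swap b c | s-pred-swap b d =
    permute (s (a - b)) (s (a - c)) (s (a - d)) (s (b - c)) (s (b - d)) (s (c - d))
    where
    permute : ∀ ab ac ad bc bd cd →
      ac + ad + (ab + + 1) + cd + bc + bd ≡ ab + ac + ad + bc + bd + cd + + 1
    permute = solve-∀

  dinvBy-removeAppend₂ : ∀ a b c d → s (a - (c - + 1)) ≡ s (a - c) →
    s (b - (c - + 1)) ≡ s (b - c) + + 1 →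
    dinvBy s (removeAppend 2 ⟨ a , b , c , d ⟩) ≡ dinvBy s ⟨ a , b , c , d ⟩ + + 1
  dinvBy-removeAppend₂ a b c d keep gain
    rewrite keep | gain | s-pred-swap c d =
    permute (s (a - b)) (s (a - c)) (s (a - d)) (s (b - c)) (s (b - d)) (s (c - d))
    where
    permute : ∀ ab ac ad bc bd cd →
      ab + ad + ac + bd + (bc + + 1) + cd ≡ ab + ac + ad + bc + bd + cd + + 1
    permute = solve-∀

  dinvBy-removeAppend₃ : ∀ a b c d → s (a - (d - + 1)) ≡ s (a - d) →
    s (b - (d - + 1)) ≡ s (b - d) →
    s (c - (d - + 1)) ≡ s (c - d) + + 1 →
    dinvBy s (removeAppend 3 ⟨ a , b , c , d ⟩) ≡ dinvBy s ⟨ a , b , c , d ⟩ + + 1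
  dinvBy-removeAppend₃ a b c d keep-a keep-b gain
    rewrite keep-a | keep-b | gain =
    permute (s (a - b)) (s (a - c)) (s (a - d)) (s (b - c)) (s (b - d)) (s (c - d))
    where
    permute : ∀ ab ac ad bc bd cd →
      ab + ac + ad + bc + bd + (cd + + 1) ≡ ab + ac + ad + bc + bd + cd + + 1
    permute = solve-∀

  dinvBy-f1 : ∀ b c d → s (+ 0 - (b - + 1)) ≡ s (+ 0 - b) + + 1 →
    s (+ 0 - (c - + 1)) ≡ s (+ 0 - c) →
    s ((d + + 1) - (c - + 1)) ≡ s (c - d) → s ((d + + 1) - (b - + 1)) ≡ s (b - d) + + 1 →
    s (+ 0 - d) ≡ s (+ 0 - (d + + 1)) + + 1 →
    dinvBy s (f1 ⟨ + 0 , b , c , d ⟩) ≡ dinvBy s ⟨ + 0 , b , c , d ⟩ + + 1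
  dinvBy-f1 b c d b-gain c-keep cd-keep bd-gain d-loss
    rewrite b-gain | c-keep | cd-keep | bd-gain | d-loss | pred-minus-pred b c =
    permute (s (+ 0 - (d + + 1))) (s (+ 0 - b)) (s (+ 0 - c)) (s (b - c)) (s (b - d)) (s (c - d))
    where
    permute : ∀ d′ b′ c′ bc bd cd →
      d′ + (b′ + + 1) + c′ + (bd + + 1) + cd + bc ≡ b′ + c′ + (d′ + + 1) + bc + bd + cd + + 1
    permute = solve-∀

-- sc m and scℤ (+ m) unfold to the same term; with m an integer variable M, the ring solver
-- can treat it as an atom.
scℤ : ℤ → ℤ → ℤ
scℤ M p =
  if ⌊ + 1 ≤? p ⌋ ∧ ⌊ p ≤? M ⌋ then (M + + 1) - p
  else if ⌊ (+ 0 - M) ≤? p ⌋ ∧ ⌊ p ≤? + 0 ⌋ then M + p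
  else + 0

scℤ-pos : ∀ M p → + 1 ≤ p → p ≤ M → scℤ M p ≡ (M + + 1) - p
scℤ-pos M p 1≤p p≤M with + 1 ≤? p | p ≤? M
... | yes _ | yes _  = refl
... | no 1≰p | _     = contradiction 1≤p 1≰p
... | yes _ | no p≰M = contradiction p≤M p≰M

scℤ-nonpos : ∀ M p → + 0 - M ≤ p → p ≤ + 0 → scℤ M p ≡ M + p
scℤ-nonpos M p -M≤p p≤0 with + 1 ≤? p
... | yes 1≤p = contradiction (≤-trans 1≤p p≤0) 1≰0
... | no _ with (+ 0 - M) ≤? p | p ≤? + 0
...   | yes _ | yes _     = refl
...   | no -M≰p | _       = contradiction -M≤p -M≰p
...   | yes _ | no p≰0    = contradiction p≤0 p≰0

module _ {M : ℤ} (0≤M : + 0 ≤ M) where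

  scℤ-≤-M : ∀ p → p ≤ + 0 - M → scℤ M p ≡ + 0
  scℤ-≤-M p p≤-M with + 1 ≤? p
  ... | yes 1≤p =
    contradiction (≤-fromGap (+-mono-≤ (+-mono-≤ 1≤p p≤-M) 0≤M) (solve (M ∷ p ∷ []))) 1≰0
  ... | no _ with (+ 0 - M) ≤? p | p ≤? + 0
  ...   | yes -M≤p | yes _ = begin
          M + p          ≡⟨ cong (λ q → M + q) (≤-antisym p≤-M -M≤p) ⟩
          M + (+ 0 - M)  ≡⟨ solve (M ∷ []) ⟩
          + 0            ∎
  ...   | yes _ | no _ = refl
  ...   | no _ | _     = refl

  scℤ->M : ∀ p → M < p → scℤ M p ≡ + 0
  scℤ->M p M<p with + 1 ≤? p | p ≤? M | (+ 0 - M) ≤? p | p ≤? + 0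
  ... | _ | yes p≤M | _ | _          = contradiction p≤M (<⇒≱ M<p)
  ... | _ | _ | _ | yes p≤0          = contradiction p≤0 (<⇒≱ (≤-<-trans 0≤M M<p))
  ... | yes _ | no _ | yes _ | no _  = refl
  ... | yes _ | no _ | no _ | no _   = refl
  ... | no _ | no _ | yes _ | no _   = refl
  ... | no _ | no _ | no _ | no _    = refl

  scℤ-reflect : ∀ p → scℤ M (+ 1 - p) ≡ scℤ M p
  scℤ-reflect p with ≤⊎> p (+ 0 - M)
  ... | inj₁ p≤-M = begin
        scℤ M (+ 1 - p)  ≡⟨ scℤ->M (+ 1 - p) (1+≤⇒< (≤-fromGap p≤-M (solve (M ∷ p ∷ [])))) ⟩
        + 0              ≡⟨ sym (scℤ-≤-M p p≤-M) ⟩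
        scℤ M p          ∎
  ... | inj₂ -M<p with ≤⊎> p (+ 0)
  ...   | inj₁ p≤0 = begin
          scℤ M (+ 1 - p)        ≡⟨ scℤ-pos M (+ 1 - p) (≤-fromGap p≤0 (solve (p ∷ [])))
                                            (≤-fromGap (<⇒1+≤ -M<p) (solve (M ∷ p ∷ []))) ⟩
          (M + + 1) - (+ 1 - p)  ≡⟨ solve (M ∷ p ∷ []) ⟩
          M + p                  ≡⟨ sym (scℤ-nonpos M p (<⇒≤ -M<p) p≤0) ⟩
          scℤ M p                ∎
  ...   | inj₂ 0<p with ≤⊎> p M
  ...     | inj₁ p≤M = begin
            scℤ M (+ 1 - p)  ≡⟨ scℤ-nonpos M (+ 1 - p)
                                  (≤-fromGap (+-mono-≤ p≤M 0≤1) (solve (M ∷ p ∷ [])))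
                                  (≤-fromGap (<⇒1+≤ 0<p) (solve (p ∷ []))) ⟩
            M + (+ 1 - p)    ≡⟨ solve (M ∷ p ∷ []) ⟩
            (M + + 1) - p    ≡⟨ sym (scℤ-pos M p (<⇒1+≤ 0<p) p≤M) ⟩
            scℤ M p          ∎
  ...     | inj₂ M<p = begin
            scℤ M (+ 1 - p)  ≡⟨ scℤ-≤-M (+ 1 - p) (≤-fromGap (<⇒1+≤ M<p) (solve (M ∷ p ∷ []))) ⟩
            + 0              ≡⟨ sym (scℤ->M p M<p) ⟩
            scℤ M p          ∎

  scℤ-pred-near : ∀ u x → x ≤ u + M → u < x → scℤ M (u - (x - + 1)) ≡ scℤ M (u - x) + + 1
  scℤ-pred-near u x x≤u+M u<x = begin
    scℤ M (u - (x - + 1))    ≡⟨ cong (scℤ M) pred-shift ⟩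
    scℤ M ((u - x) + + 1)    ≡⟨ scℤ-nonpos M ((u - x) + + 1)
                                  (≤-fromGap (+-mono-≤ -M≤u-x 0≤1) (solve (M ∷ u ∷ x ∷ [])))
                                  (≤-fromGap (<⇒1+≤ u<x) (solve (u ∷ x ∷ []))) ⟩
    M + ((u - x) + + 1)      ≡⟨ solve (M ∷ u ∷ x ∷ []) ⟩
    (M + (u - x)) + + 1      ≡⟨ cong (_+ + 1) (sym (scℤ-nonpos M (u - x) -M≤u-x u-x≤0)) ⟩
    scℤ M (u - x) + + 1      ∎
    where
    pred-shift : u - (x - + 1) ≡ (u - x) + + 1
    pred-shift = solve (u ∷ x ∷ [])
    -M≤u-x : + 0 - M ≤ u - x
    -M≤u-x = ≤-fromGap x≤u+M (solve (M ∷ u ∷ x ∷ []))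
    u-x≤0 : u - x ≤ + 0
    u-x≤0 = ≤-fromGap (<⇒≤ u<x) (solve (u ∷ x ∷ []))

  scℤ-pred-far : ∀ u x → M < x - u → scℤ M (u - (x - + 1)) ≡ scℤ M (u - x)
  scℤ-pred-far u x M<x-u = begin
    scℤ M (u - (x - + 1))  ≡⟨ scℤ-≤-M (u - (x - + 1))
                                (≤-fromGap (<⇒1+≤ M<x-u) (solve (M ∷ u ∷ x ∷ []))) ⟩
    + 0                    ≡⟨ sym (scℤ-≤-M (u - x) (≤-fromGap (<⇒≤ M<x-u) (solve (M ∷ u ∷ x ∷ [])))) ⟩
    scℤ M (u - x)          ∎

  dinvℤ-f0-r₂ : ∀ {b c d} → b ≤ + 0 + M → + 0 < b →
    dinvBy (scℤ M) (removeAppend 1 ⟨ + 0 , b , c , d ⟩) ≡ dinvBy (scℤ M) ⟨ + 0 , b , c , d ⟩ + + 1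
  dinvℤ-f0-r₂ {b} {c} {d} b≤M 0<b =
    dinvBy-removeAppend₁ (scℤ M) scℤ-reflect (+ 0) b c d (scℤ-pred-near (+ 0) b b≤M 0<b)

  dinvℤ-f0-r₃ : ∀ {b c d} → M < c - + 0 → b ≤ + 0 + M → c ≤ b + M →
    dinvBy (scℤ M) (removeAppend 2 ⟨ + 0 , b , c , d ⟩) ≡ dinvBy (scℤ M) ⟨ + 0 , b , c , d ⟩ + + 1
  dinvℤ-f0-r₃ {b} {c} {d} M<c b≤M c≤b+M =
    dinvBy-removeAppend₂ (scℤ M) scℤ-reflect (+ 0) b c d
      (scℤ-pred-far (+ 0) c M<c) (scℤ-pred-near b c c≤b+M b<c)
    where
    b<c : b < c
    b<c = 1+≤⇒< (≤-fromGap (+-mono-≤ b≤M (<⇒1+≤ M<c)) (solve (M ∷ b ∷ c ∷ [])))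

  dinvℤ-f0-r₄ : ∀ {b c d} → M < d - b → + 0 ≤ b → c ≤ b + M → d ≤ c + M →
    dinvBy (scℤ M) (removeAppend 3 ⟨ + 0 , b , c , d ⟩) ≡ dinvBy (scℤ M) ⟨ + 0 , b , c , d ⟩ + + 1
  dinvℤ-f0-r₄ {b} {c} {d} M<d-b 0≤b c≤b+M d≤c+M =
    dinvBy-removeAppend₃ (scℤ M) scℤ-reflect (+ 0) b c d
      (scℤ-pred-far (+ 0) d M<d) (scℤ-pred-far b d M<d-b) (scℤ-pred-near c d d≤c+M c<d)
    where
    M<d : M < d - + 0
    M<d = 1+≤⇒< (≤-fromGap (+-mono-≤ (<⇒1+≤ M<d-b) 0≤b) (solve (M ∷ b ∷ d ∷ [])))
    c<d : c < d
    c<d = 1+≤⇒< (≤-fromGap (+-mono-≤ c≤b+M (<⇒1+≤ M<d-b)) (solve (M ∷ b ∷ c ∷ d ∷ [])))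

  dinvℤ-f1 : ∀ {b c d} → b ≤ + 0 + M → c ≤ b + M → + 0 ≤ d → M + + 1 < c - d →
    dinvBy (scℤ M) (f1 ⟨ + 0 , b , c , d ⟩) ≡ dinvBy (scℤ M) ⟨ + 0 , b , c , d ⟩ + + 1
  dinvℤ-f1 {b} {c} {d} b≤M c≤b+M 0≤d M+1<c-d =
    dinvBy-f1 (scℤ M) scℤ-reflect b c d
      (scℤ-pred-near (+ 0) b b≤M 0<b) (scℤ-pred-far (+ 0) c M<c) cd-vanish bd-gain d-loss
    where
    d+1<b : d + + 1 < b
    d+1<b = 1+≤⇒< (≤-fromGap (+-mono-≤ c≤b+M (<⇒1+≤ M+1<c-d)) (solve (M ∷ b ∷ c ∷ d ∷ [])))
    0<b : + 0 < b
    0<b = 1+≤⇒< (≤-fromGap (+-mono-≤ (<⇒1+≤ d+1<b) (+-mono-≤ 0≤d 0≤1)) (solve (b ∷ d ∷ [])))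
    M<c : M < c - + 0
    M<c = 1+≤⇒< (≤-fromGap (+-mono-≤ (<⇒1+≤ M+1<c-d) (+-mono-≤ 0≤d 0≤1)) (solve (M ∷ c ∷ d ∷ [])))
    M<c-d : M < c - d
    M<c-d = 1+≤⇒< (≤-fromGap (+-mono-≤ (<⇒1+≤ M+1<c-d) 0≤1) (solve (M ∷ c ∷ d ∷ [])))
    b≤d+1+M : b ≤ (d + + 1) + M
    b≤d+1+M = ≤-fromGap (+-mono-≤ b≤M (+-mono-≤ 0≤d 0≤1)) (solve (M ∷ b ∷ d ∷ []))
    cd-vanish : scℤ M ((d + + 1) - (c - + 1)) ≡ scℤ M (c - d)
    cd-vanish = begin
      scℤ M ((d + + 1) - (c - + 1))  ≡⟨ scℤ-≤-M ((d + + 1) - (c - + 1))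
                                          (≤-fromGap (<⇒1+≤ M+1<c-d) (solve (M ∷ c ∷ d ∷ []))) ⟩
      + 0                            ≡⟨ sym (scℤ->M (c - d) M<c-d) ⟩
      scℤ M (c - d)                  ∎
    bd-gain : scℤ M ((d + + 1) - (b - + 1)) ≡ scℤ M (b - d) + + 1
    bd-gain = begin
      scℤ M ((d + + 1) - (b - + 1))  ≡⟨ scℤ-pred-near (d + + 1) b b≤d+1+M d+1<b ⟩
      scℤ M ((d + + 1) - b) + + 1    ≡⟨ cong (λ q → scℤ M q + + 1) reflection ⟩
      scℤ M (+ 1 - (b - d)) + + 1    ≡⟨ cong (_+ + 1) (scℤ-reflect (b - d)) ⟩
      scℤ M (b - d) + + 1            ∎
      where
      reflection : (d + + 1) - b ≡ + 1 - (b - d)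
      reflection = solve (b ∷ d ∷ [])
    d-loss : scℤ M (+ 0 - d) ≡ scℤ M (+ 0 - (d + + 1)) + + 1
    d-loss = begin
      scℤ M (+ 0 - d)                    ≡⟨ cong (scℤ M) d≡d+1-1 ⟩
      scℤ M (+ 0 - ((d + + 1) - + 1))    ≡⟨ scℤ-pred-near (+ 0) (d + + 1) (<⇒≤ (<-≤-trans d+1<b b≤M))
                                              (1+≤⇒< (≤-fromGap 0≤d (solve (d ∷ [])))) ⟩
      scℤ M (+ 0 - (d + + 1)) + + 1      ∎
      where
      d≡d+1-1 : + 0 - d ≡ + 0 - ((d + + 1) - + 1)
      d≡d+1-1 = solve (d ∷ [])

area-removeAppend : ∀ k γ → area (removeAppend k γ) ≡ area γ - + 1
area-removeAppend 0 ⟨ a , b , c , d ⟩ = begin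
  a + b + c + (d - + 1)  ≡⟨ solve (a ∷ b ∷ c ∷ d ∷ []) ⟩
  a + b + c + d - + 1    ∎
area-removeAppend 1 ⟨ a , b , c , d ⟩ = begin
  a + c + d + (b - + 1)  ≡⟨ solve (a ∷ b ∷ c ∷ d ∷ []) ⟩
  a + b + c + d - + 1    ∎
area-removeAppend 2 ⟨ a , b , c , d ⟩ = begin
  a + b + d + (c - + 1)  ≡⟨ solve (a ∷ b ∷ c ∷ d ∷ []) ⟩
  a + b + c + d - + 1    ∎
area-removeAppend (ℕ.suc (ℕ.suc (ℕ.suc _))) ⟨ a , b , c , d ⟩ = begin
  a + b + c + (d - + 1)  ≡⟨ solve (a ∷ b ∷ c ∷ d ∷ []) ⟩
  a + b + c + d - + 1    ∎

area-f1 : ∀ b c d → area (f1 ⟨ + 0 , b , c , d ⟩) ≡ area ⟨ + 0 , b , c , d ⟩ - + 1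
area-f1 b c d = begin
  + 0 + (d + + 1) + (b - + 1) + (c - + 1)  ≡⟨ solve (b ∷ c ∷ d ∷ []) ⟩
  + 0 + b + c + d - + 1                    ∎

dinv-f0 : ∀ m γ → InA0 m γ → dinv m (f0 m γ) ≡ dinv m γ + + 1
dinv-f0 m ⟨ _ , b , c , d ⟩ ((refl , 0≤b , _ , _ , b≤m , c≤b+m , d≤c+m) , _ , 0<b)
  with c - + 0 ≤? + m | d - b ≤? + m
... | yes _   | _        = dinvℤ-f0-r₂ (+≤+ z≤n) b≤m 0<b
... | no c≰m  | yes _    = dinvℤ-f0-r₃ (+≤+ z≤n) (≰⇒> c≰m) b≤m c≤b+m
... | no _    | no d-b≰m = dinvℤ-f0-r₄ (+≤+ z≤n) (≰⇒> d-b≰m) 0≤b c≤b+m d≤c+m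

lemma4p4 : (m : ℕ) → 1 Data.Nat.≤ m → (γ : Seq4) → (h : InA m γ) →
    (area (f m γ h) ≡ area γ - + 1) × (dinv m (f m γ h) ≡ dinv m γ + + 1)
lemma4p4 m _ γ (inj₁ γ∈A₀) = area-removeAppend (rr m γ ℕ.∸ 1) γ , dinv-f0 m γ γ∈A₀
lemma4p4 m _ ⟨ _ , b , c , d ⟩ (inj₂ ((refl , _ , _ , 0≤d , b≤m , c≤b+m , _) , _ , m+1<c-d)) =
  area-f1 b c d , dinvℤ-f1 (+≤+ z≤n) b≤m c≤b+m 0≤d m+1<c-d
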